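{- Let $N$ be an even integer with $N \geq 2$, and let $C_N$ be the adjacency matrix of the modular Collatz graph $G_N$. Then the rank of $C_N$ equals $N/2$.
   Context: The Collatz function is $T(n) = n/2$ if $n$ is even and $T(n) = (3n+1)/2$ if $n$ is odd, for nonnegative integers $n$. For an integer $N > 1$ the modular Collatz graph $G_N$ has vertex set $\mathbb{Z}_N = \{0,1,\ldots,N-1\}$ and adjacency matrix $C_N = (c_{i,j})_{0 \le i,j \le N-1}$ with $c_{i,j} = \#\{\nu \in \{i, i+N\} : T(\nu) \equiv j \pmod N\}$. -}

module Defs where

open import Data.Nat as ℕ using (ℕ; zero; suc; NonZero)
open import Data.Nat.DivMod using (_/_; _%_)
open import Data.Fin using (Fin; toℕ; zero; suc)
open import Data.Bool using (if_then_else_)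
open import Data.Integer using (+_)
open import Data.Rational as ℚ using (ℚ; 0ℚ)
open import Data.Product using (Σ; _×_)
open import Relation.Nullary using (¬_; does)
open import Relation.Binary.PropositionalEquality using (_≡_)

T : ℕ → ℕ
T n = if does (n % 2 ℕ.≟ 0) then n / 2 else (3 ℕ.* n ℕ.+ 1) / 2

δ : ℕ → ℕ → ℕ
δ a b = if does (a ℕ.≟ b) then 1 else 0

-- Adjacency matrix C_N of the modular Collatz graph G_N:
-- c i j = #{ ν ∈ {i, i+N} : T ν ≡ j (mod N) }
collatzMatrix : (N : ℕ) .{{_ : NonZero N}} → Fin N → Fin N → ℕ
collatzMatrix N i j =
  δ (T (toℕ i) % N) (toℕ j) ℕ.+ δ (T (toℕ i ℕ.+ N) % N) (toℕ j)

toℚ : ℕ → ℚ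
toℚ n = (+ n) ℚ./ 1

∑ : (k : ℕ) → (Fin k → ℚ) → ℚ
∑ zero f = 0ℚ
∑ (suc k) f = f zero ℚ.+ ∑ k (λ i → f (suc i))


LinIndep : {N : ℕ} (k : ℕ) → (Fin k → Fin N → ℚ) → Set
LinIndep k v = (c : Fin k → ℚ) → (∀ j → ∑ k (λ i → c i ℚ.* v i j) ≡ 0ℚ) → ∀ i → c i ≡ 0ℚ

column : {N : ℕ} → (Fin N → Fin N → ℕ) → Fin N → Fin N → ℚ
column M j i = toℚ (M i j)

HasRank : {N : ℕ} → (Fin N → Fin N → ℕ) → ℕ → Set
HasRank {N} M r =
  Σ (Fin r → Fin N) (λ s → LinIndep r (λ i → column M (s i)))
  × ((s : Fin (suc r) → Fin N) → ¬ LinIndep (suc r) (λ i → column M (s i)))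

-- Write N = 2Q. Since T(n + 2Q) is T(n) + Q or T(n) + 3Q according to the parity of n,
-- row i of C_N is the indicator of the antipodal pair {T(i), T(i) + Q} in ℤ_N, that is
-- c_{i,j} = [T(i) ≡ j (mod Q)]. So column j depends only on j mod Q, and any Q + 1 columns
-- contain a repeated one (pigeonhole); while T(2k) = k makes rows 0, 2, …, 2Q − 2 against
-- columns 0, …, Q − 1 an identity minor, so those Q columns are independent.
module Submission where

open import Defs
open import Data.Nat using (ℕ; NonZero; _≤_)
open import Data.Nat.DivMod using (_/_)
open import Data.Nat.Divisibility using (_∣_)

open import Data.Nat as ℕ using (zero; suc; _+_; _*_; _<_; _≟_; _<?_)
open import Data.Nat.Properties
  using (+-identityʳ; +-comm; +-assoc; *-comm; +-cancelʳ-≡; m≤n+m; <⇒≱; n<1+n; m*n≢0; 1+n≢0; ≮⇒≥; m∸n+n≡m;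
         m<n+o⇒m∸n<o; *-monoˡ-<; <-≤-trans; m≤m*n; +-monoˡ-<; m<m*n; ≤-refl)
open import Data.Nat.DivMod
  using (_%_; _mod_; m<n⇒m%n≡m; [m+n]%n≡m%n; [m+kn]%n≡m%n; %-distribˡ-+; m%n<n;
         m∣n⇒o%n%m≡o%m; m*n%n≡0; m*n/n≡m; +-distrib-/-∣ʳ)
open import Data.Nat.Divisibility using (divides)
open import Data.Nat.Tactic.RingSolver using (solve-∀)
open import Data.Fin as Fin using (Fin; toℕ; fromℕ<)
open import Data.Fin.Properties using (toℕ<n; toℕ-fromℕ<; toℕ-inject≤; toℕ-injective; suc-injective; pigeonhole; <⇒≢)
open import Data.Bool using (if_then_else_)
open import Data.Rational using (ℚ; 0ℚ; 1ℚ; -_) renaming (_+_ to _+ℚ_; _*_ to _*ℚ_)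
open import Data.Rational.Properties
  using (+-identityˡ; *-identityʳ; *-zeroˡ; *-zeroʳ; *-distribʳ-+; +-inverseʳ)
  renaming (+-identityʳ to +ℚ-identityʳ; +-comm to +ℚ-comm; 1≢0 to 1ℚ≢0ℚ)
open import Data.Product using (_,_)
open import Data.Sum using (_⊎_; inj₁; inj₂)
open import Data.Empty using (⊥-elim)
open import Function using (_∘_)
open import Relation.Nullary using (¬_; yes; no; does)
open import Relation.Nullary.Decidable using (dec-true; dec-false)
open import Relation.Binary.PropositionalEquality

δ-refl : ∀ a → δ a a ≡ 1
δ-refl a rewrite dec-true (a ≟ a) refl = refl

δ-≢ : ∀ {a b} → a ≢ b → δ a b ≡ 0
δ-≢ {a} {b} a≢b rewrite dec-false (a ≟ b) a≢b = refl

δ-+ : ∀ a b c → δ (a + c) (b + c) ≡ δ a b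
δ-+ a b c with a ≟ b
... | yes refl = trans (δ-refl (a + c)) (sym (δ-refl a))
... | no a≢b   = trans (δ-≢ (a≢b ∘ +-cancelʳ-≡ c a b)) (sym (δ-≢ a≢b))

∑-zero : ∀ k (f : Fin k → ℚ) → (∀ i → f i ≡ 0ℚ) → ∑ k f ≡ 0ℚ
∑-zero zero    f f≡0 = refl
∑-zero (suc k) f f≡0 = cong₂ _+ℚ_ (f≡0 Fin.zero) (∑-zero k (f ∘ Fin.suc) (f≡0 ∘ Fin.suc))

∑-single : ∀ k (f : Fin k → ℚ) p → (∀ i → i ≢ p → f i ≡ 0ℚ) → ∑ k f ≡ f p
∑-single (suc k) f Fin.zero f≡0 = begin
  f Fin.zero +ℚ ∑ k (f ∘ Fin.suc) ≡⟨ cong (f Fin.zero +ℚ_) (∑-zero k _ (λ i → f≡0 (Fin.suc i) λ ())) ⟩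
  f Fin.zero +ℚ 0ℚ                ≡⟨ +ℚ-identityʳ _ ⟩
  f Fin.zero                      ∎
  where open ≡-Reasoning
∑-single (suc k) f (Fin.suc p) f≡0 = begin
  f Fin.zero +ℚ ∑ k (f ∘ Fin.suc) ≡⟨ cong₂ _+ℚ_ (f≡0 Fin.zero λ ())
                                      (∑-single k _ p (λ i i≢p → f≡0 (Fin.suc i) (i≢p ∘ suc-injective))) ⟩
  0ℚ +ℚ f (Fin.suc p)             ≡⟨ +-identityˡ _ ⟩
  f (Fin.suc p)                   ∎
  where open ≡-Reasoning

∑-pair : ∀ k (f : Fin k → ℚ) {p q} → p ≢ q → (∀ i → i ≢ p → i ≢ q → f i ≡ 0ℚ) → ∑ k f ≡ f p +ℚ f q
∑-pair (suc k) f {Fin.zero} {Fin.zero} p≢q f≡0 = ⊥-elim (p≢q refl)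
∑-pair (suc k) f {Fin.zero} {Fin.suc q} p≢q f≡0 =
  cong (f Fin.zero +ℚ_) (∑-single k _ q (λ i i≢q → f≡0 (Fin.suc i) (λ ()) (i≢q ∘ suc-injective)))
∑-pair (suc k) f {Fin.suc p} {Fin.zero} p≢q f≡0 =
  trans (cong (f Fin.zero +ℚ_) (∑-single k _ p (λ i i≢p → f≡0 (Fin.suc i) (i≢p ∘ suc-injective) (λ ()))))
        (+ℚ-comm (f Fin.zero) (f (Fin.suc p)))
∑-pair (suc k) f {Fin.suc p} {Fin.suc q} p≢q f≡0 =
  trans (cong₂ _+ℚ_ (f≡0 Fin.zero (λ ()) (λ ()))
          (∑-pair k _ (p≢q ∘ cong Fin.suc)
            (λ i i≢p i≢q → f≡0 (Fin.suc i) (i≢p ∘ suc-injective) (i≢q ∘ suc-injective))))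
        (+-identityˡ _)

repeated⇒¬LinIndep : ∀ {N k} (v : Fin k → Fin N → ℚ) {p q} →
                     p ≢ q → (∀ j → v p j ≡ v q j) → ¬ LinIndep k v
repeated⇒¬LinIndep {k = k} v {p} {q} p≢q vp≡vq indep =
  1ℚ≢0ℚ (trans (sym c[p]≡1) (indep c vanishes p))
  where
  c : Fin k → ℚ
  c i = if does (i Fin.≟ p) then 1ℚ else if does (i Fin.≟ q) then - 1ℚ else 0ℚ

  c[p]≡1 : c p ≡ 1ℚ
  c[p]≡1 rewrite dec-true (p Fin.≟ p) refl = refl

  c[q]≡-1 : c q ≡ - 1ℚ
  c[q]≡-1 rewrite dec-false (q Fin.≟ p) (p≢q ∘ sym) | dec-true (q Fin.≟ q) refl = refl

  c[i]≡0 : ∀ i → i ≢ p → i ≢ q → c i ≡ 0ℚ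
  c[i]≡0 i i≢p i≢q rewrite dec-false (i Fin.≟ p) i≢p | dec-false (i Fin.≟ q) i≢q = refl

  vanishes : ∀ j → ∑ k (λ i → c i *ℚ v i j) ≡ 0ℚ
  vanishes j = begin
    ∑ k (λ i → c i *ℚ v i j)          ≡⟨ ∑-pair k _ p≢q (λ i i≢p i≢q →
                                           trans (cong (_*ℚ v i j) (c[i]≡0 i i≢p i≢q)) (*-zeroˡ (v i j))) ⟩
    c p *ℚ v p j +ℚ c q *ℚ v q j      ≡⟨ cong₂ (λ a b → a *ℚ v p j +ℚ b) c[p]≡1
                                           (cong₂ _*ℚ_ c[q]≡-1 (sym (vp≡vq j))) ⟩
    1ℚ *ℚ v p j +ℚ (- 1ℚ) *ℚ v p j    ≡⟨ sym (*-distribʳ-+ (v p j) 1ℚ (- 1ℚ)) ⟩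
    (1ℚ +ℚ - 1ℚ) *ℚ v p j             ≡⟨ cong (_*ℚ v p j) (+-inverseʳ 1ℚ) ⟩
    0ℚ *ℚ v p j                       ≡⟨ *-zeroˡ (v p j) ⟩
    0ℚ                                ∎
    where open ≡-Reasoning

identityMinor⇒LinIndep : ∀ {N k} (M : Fin N → Fin N → ℕ) (r s : Fin k → Fin N) →
                         (∀ a b → M (r a) (s b) ≡ δ (toℕ a) (toℕ b)) →
                         LinIndep k (column M ∘ s)
identityMinor⇒LinIndep {k = k} M r s minor c vanishes a = begin
  c a                                     ≡⟨ *-identityʳ (c a) ⟨
  c a *ℚ toℚ 1                            ≡⟨ cong (λ x → c a *ℚ toℚ x) (trans (minor a a) (δ-refl (toℕ a))) ⟨
  c a *ℚ column M (s a) (r a)             ≡⟨ ∑-single k _ a off-diagonal ⟨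
  ∑ k (λ b → c b *ℚ column M (s b) (r a)) ≡⟨ vanishes (r a) ⟩
  0ℚ                                      ∎
  where
  open ≡-Reasoning
  off-diagonal : ∀ b → b ≢ a → c b *ℚ column M (s b) (r a) ≡ 0ℚ
  off-diagonal b b≢a = begin
    c b *ℚ toℚ (M (r a) (s b))     ≡⟨ cong (λ x → c b *ℚ toℚ x) (minor a b) ⟩
    c b *ℚ toℚ (δ (toℕ a) (toℕ b)) ≡⟨ cong (λ x → c b *ℚ toℚ x) (δ-≢ (b≢a ∘ sym ∘ toℕ-injective)) ⟩
    c b *ℚ 0ℚ                      ≡⟨ *-zeroʳ (c b) ⟩
    0ℚ                             ∎

fewColumns⇒¬LinIndep : ∀ {N Q} (M : Fin N → Fin N → ℕ) (cls : Fin N → Fin Q) →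
                       (∀ a b → cls a ≡ cls b → ∀ i → M i a ≡ M i b) →
                       (s : Fin (suc Q) → Fin N) → ¬ LinIndep (suc Q) (column M ∘ s)
fewColumns⇒¬LinIndep {Q = Q} M cls sameColumn s
  with p , q , p<q , cls≡ ← pigeonhole (n<1+n Q) (cls ∘ s) =
  repeated⇒¬LinIndep _ (<⇒≢ p<q) (cong toℚ ∘ sameColumn (s p) (s q) cls≡)

identityMinor+fewColumns⇒HasRank : ∀ {N Q} (M : Fin N → Fin N → ℕ) (cls : Fin N → Fin Q) →
  (∀ a b → cls a ≡ cls b → ∀ i → M i a ≡ M i b) →
  (r s : Fin Q → Fin N) → (∀ a b → M (r a) (s b) ≡ δ (toℕ a) (toℕ b)) →
  HasRank M Q
identityMinor+fewColumns⇒HasRank M cls sameColumn r s minor =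
  (s , identityMinor⇒LinIndep M r s minor) , fewColumns⇒¬LinIndep M cls sameColumn

n%2≡0⊎n%2≡1 : ∀ n → n % 2 ≡ 0 ⊎ n % 2 ≡ 1
n%2≡0⊎n%2≡1 n with n % 2 | m%n<n n 2
... | 0           | _                 = inj₁ refl
... | 1           | _                 = inj₂ refl
... | suc (suc _) | ℕ.s≤s (ℕ.s≤s ())

T-even : ∀ n → n % 2 ≡ 0 → T n ≡ n / 2
T-even n n%2≡0 rewrite dec-true (n % 2 ≟ 0) n%2≡0 = refl

T-odd : ∀ n → n % 2 ≡ 1 → T n ≡ (3 * n + 1) / 2
T-odd n n%2≡1 rewrite dec-false (n % 2 ≟ 0) (1+n≢0 ∘ trans (sym n%2≡1)) = refl

T[2k]≡k : ∀ k → T (k * 2) ≡ k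
T[2k]≡k k = trans (T-even (k * 2) (m*n%n≡0 k 2)) (m*n/n≡m k 2)

T[n+2q]≡T[n]+q+[n%2]*2q : ∀ n q → T (n + q * 2) ≡ T n + q + n % 2 * (q * 2)
T[n+2q]≡T[n]+q+[n%2]*2q n q with n%2≡0⊎n%2≡1 n
... | inj₁ n%2≡0 = begin
  T (n + q * 2)             ≡⟨ T-even (n + q * 2) (trans ([m+kn]%n≡m%n n q 2) n%2≡0) ⟩
  (n + q * 2) / 2           ≡⟨ +-distrib-/-∣ʳ n (divides q refl) ⟩
  n / 2 + q * 2 / 2         ≡⟨ cong₂ _+_ (sym (T-even n n%2≡0)) (m*n/n≡m q 2) ⟩
  T n + q                   ≡⟨ +-identityʳ _ ⟨
  T n + q + 0               ≡⟨ cong (λ b → T n + q + b * (q * 2)) (sym n%2≡0) ⟩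
  T n + q + n % 2 * (q * 2) ∎
  where open ≡-Reasoning
... | inj₂ n%2≡1 = begin
  T (n + q * 2)                     ≡⟨ T-odd (n + q * 2) (trans ([m+kn]%n≡m%n n q 2) n%2≡1) ⟩
  (3 * (n + q * 2) + 1) / 2         ≡⟨ cong (_/ 2) (regroup n q) ⟩
  ((3 * n + 1) + (3 * q) * 2) / 2   ≡⟨ +-distrib-/-∣ʳ (3 * n + 1) (divides (3 * q) refl) ⟩
  (3 * n + 1) / 2 + 3 * q * 2 / 2   ≡⟨ cong₂ _+_ (sym (T-odd n n%2≡1)) (m*n/n≡m (3 * q) 2) ⟩
  T n + 3 * q                       ≡⟨ split (T n) q ⟩
  T n + q + 1 * (q * 2)             ≡⟨ cong (λ b → T n + q + b * (q * 2)) (sym n%2≡1) ⟩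
  T n + q + n % 2 * (q * 2)         ∎
  where
  open ≡-Reasoning
  regroup : ∀ n q → 3 * (n + q * 2) + 1 ≡ (3 * n + 1) + (3 * q) * 2
  regroup = solve-∀
  split : ∀ t q → t + 3 * q ≡ t + q + 1 * (q * 2)
  split = solve-∀

module _ {Q : ℕ} .{{_ : NonZero Q}} where

  private instance
    2Q≢0 : NonZero (Q * 2)
    2Q≢0 = m*n≢0 Q 2

  2Q≡Q+Q : Q * 2 ≡ Q + Q
  2Q≡Q+Q = trans (*-comm Q 2) (cong (Q +_) (+-identityʳ Q))

  data Half : ℕ → Set where
    lower : ∀ {r} → r < Q → Half r
    upper : ∀ {r} → r < Q → Half (r + Q)

  half : ∀ {r} → r < Q * 2 → Half r
  half {r} r<2Q with r <? Q
  ... | yes r<Q = lower r<Q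
  ... | no  r≮Q = subst Half (m∸n+n≡m (≮⇒≥ r≮Q))
                    (upper (m<n+o⇒m∸n<o r Q (subst (r <_) 2Q≡Q+Q r<2Q)))

  r<Q⇒r+Q<2Q : ∀ {r} → r < Q → r + Q < Q * 2
  r<Q⇒r+Q<2Q {r} r<Q = subst (r + Q <_) (sym 2Q≡Q+Q) (+-monoˡ-< Q r<Q)

  [r+Q]%Q≡r : ∀ {r} → r < Q → (r + Q) % Q ≡ r
  [r+Q]%Q≡r {r} r<Q = trans ([m+n]%n≡m%n r Q) (m<n⇒m%n≡m r<Q)

  [r+Q+Q]%2Q≡r : ∀ {r} → r < Q → (r + Q + Q) % (Q * 2) ≡ r
  [r+Q+Q]%2Q≡r {r} r<Q = begin
    (r + Q + Q) % (Q * 2)   ≡⟨ cong (_% (Q * 2)) (trans (+-assoc r Q Q) (cong (r +_) (sym 2Q≡Q+Q))) ⟩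
    (r + Q * 2) % (Q * 2)   ≡⟨ [m+n]%n≡m%n r (Q * 2) ⟩
    r % (Q * 2)             ≡⟨ m<n⇒m%n≡m (<-≤-trans r<Q (m≤m*n Q 2)) ⟩
    r                       ∎
    where open ≡-Reasoning

  δ-lower+δ-upper : ∀ {r j} → r < Q → j < Q * 2 → δ r j + δ (r + Q) j ≡ δ r (j % Q)
  δ-lower+δ-upper {r} r<Q j<2Q with half j<2Q
  ... | lower {j} j<Q = begin
    δ r j + δ (r + Q) j   ≡⟨ cong (δ r j +_) (δ-≢ λ r+Q≡j → <⇒≱ j<Q (subst (Q ≤_) r+Q≡j (m≤n+m Q r))) ⟩
    δ r j + 0             ≡⟨ +-identityʳ _ ⟩
    δ r j                 ≡⟨ cong (δ r) (m<n⇒m%n≡m j<Q) ⟨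
    δ r (j % Q)           ∎
    where open ≡-Reasoning
  ... | upper {j} j<Q = begin
    δ r (j + Q) + δ (r + Q) (j + Q) ≡⟨ cong₂ _+_ (δ-≢ λ r≡j+Q → <⇒≱ r<Q (subst (Q ≤_) (sym r≡j+Q) (m≤n+m Q j)))
                                                  (δ-+ r j Q) ⟩
    δ r j                           ≡⟨ cong (δ r) ([r+Q]%Q≡r j<Q) ⟨
    δ r ((j + Q) % Q)               ∎
    where open ≡-Reasoning

  δ-antipodes : ∀ {r j} → r < Q * 2 → j < Q * 2 → δ r j + δ ((r + Q) % (Q * 2)) j ≡ δ (r % Q) (j % Q)
  δ-antipodes {r} {j} r<2Q j<2Q with half r<2Q
  ... | lower {r} r<Q rewrite m<n⇒m%n≡m (r<Q⇒r+Q<2Q r<Q) | m<n⇒m%n≡m r<Q =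
    δ-lower+δ-upper r<Q j<2Q
  ... | upper {r} r<Q rewrite [r+Q+Q]%2Q≡r r<Q | [r+Q]%Q≡r r<Q =
    trans (+-comm (δ (r + Q) j) (δ r j)) (δ-lower+δ-upper r<Q j<2Q)

  T[i+2Q]%2Q≡[T[i]+Q]%2Q : ∀ i → T (i + Q * 2) % (Q * 2) ≡ (T i + Q) % (Q * 2)
  T[i+2Q]%2Q≡[T[i]+Q]%2Q i =
    trans (cong (_% (Q * 2)) (T[n+2q]≡T[n]+q+[n%2]*2q i Q)) ([m+kn]%n≡m%n (T i + Q) (i % 2) (Q * 2))

  collatzMatrix-entry : ∀ i j → collatzMatrix (Q * 2) i j ≡ δ (T (toℕ i) % Q) (toℕ j % Q)
  collatzMatrix-entry i j = begin
    δ (t % N) j′ + δ (T (toℕ i + N) % N) j′ ≡⟨ cong (λ x → δ (t % N) j′ + δ x j′) (T[i+2Q]%2Q≡[T[i]+Q]%2Q (toℕ i)) ⟩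
    δ (t % N) j′ + δ ((t + Q) % N) j′       ≡⟨ cong (λ x → δ (t % N) j′ + δ x j′) [t+Q]%N≡[t%N+Q]%N ⟩
    δ (t % N) j′ + δ ((t % N + Q) % N) j′   ≡⟨ δ-antipodes (m%n<n t N) (toℕ<n j) ⟩
    δ (t % N % Q) (j′ % Q)                  ≡⟨ cong (λ x → δ x (j′ % Q)) (m∣n⇒o%n%m≡o%m Q N t (divides 2 (*-comm Q 2))) ⟩
    δ (t % Q) (j′ % Q)                      ∎
    where
    open ≡-Reasoning
    N = Q * 2
    t = T (toℕ i)
    j′ = toℕ j
    [t+Q]%N≡[t%N+Q]%N : (t + Q) % N ≡ (t % N + Q) % N
    [t+Q]%N≡[t%N+Q]%N = trans (%-distribˡ-+ t Q N)
      (cong (λ x → (t % N + x) % N) (m<n⇒m%n≡m (m<m*n Q 2 ≤-refl)))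

  collatzMatrix-sameColumn : ∀ a b → toℕ a mod Q ≡ toℕ b mod Q →
                             ∀ i → collatzMatrix (Q * 2) i a ≡ collatzMatrix (Q * 2) i b
  collatzMatrix-sameColumn a b a≡b i = begin
    collatzMatrix (Q * 2) i a     ≡⟨ collatzMatrix-entry i a ⟩
    δ (T (toℕ i) % Q) (toℕ a % Q) ≡⟨ cong (δ (T (toℕ i) % Q)) a%Q≡b%Q ⟩
    δ (T (toℕ i) % Q) (toℕ b % Q) ≡⟨ collatzMatrix-entry i b ⟨
    collatzMatrix (Q * 2) i b     ∎
    where
    open ≡-Reasoning
    a%Q≡b%Q : toℕ a % Q ≡ toℕ b % Q
    a%Q≡b%Q = trans (sym (toℕ-fromℕ< _)) (trans (cong toℕ a≡b) (toℕ-fromℕ< _))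

  double : Fin Q → Fin (Q * 2)
  double k = fromℕ< (*-monoˡ-< 2 (toℕ<n k))

  collatzMatrix-identityMinor : ∀ k l →
    collatzMatrix (Q * 2) (double k) (Fin.inject≤ l (m≤m*n Q 2)) ≡ δ (toℕ k) (toℕ l)
  collatzMatrix-identityMinor k l = begin
    collatzMatrix (Q * 2) (double k) l′                ≡⟨ collatzMatrix-entry (double k) l′ ⟩
    δ (T (toℕ (double k)) % Q) (toℕ l′ % Q)            ≡⟨ cong₂ (λ a b → δ (T a % Q) (b % Q))
                                                           (toℕ-fromℕ< (*-monoˡ-< 2 (toℕ<n k))) (toℕ-inject≤ l _) ⟩
    δ (T (toℕ k * 2) % Q) (toℕ l % Q)                  ≡⟨ cong (λ a → δ (a % Q) (toℕ l % Q)) (T[2k]≡k (toℕ k)) ⟩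
    δ (toℕ k % Q) (toℕ l % Q)                          ≡⟨ cong₂ δ (m<n⇒m%n≡m (toℕ<n k)) (m<n⇒m%n≡m (toℕ<n l)) ⟩
    δ (toℕ k) (toℕ l)                                  ∎
    where
    open ≡-Reasoning
    l′ = Fin.inject≤ l (m≤m*n Q 2)

  collatzMatrix-hasRank : HasRank (collatzMatrix (Q * 2)) Q
  collatzMatrix-hasRank =
    identityMinor+fewColumns⇒HasRank (collatzMatrix (Q * 2)) (λ j → toℕ j mod Q) collatzMatrix-sameColumn
      double (λ l → Fin.inject≤ l (m≤m*n Q 2)) collatzMatrix-identityMinor

lemma2p8 : (N : ℕ) .{{_ : NonZero N}} → 2 ≤ N → 2 ∣ N → HasRank (collatzMatrix N) (N / 2)
lemma2p8 _ () (divides zero refl)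
lemma2p8 _ _ (divides (suc m) refl) =
  subst (HasRank (collatzMatrix (suc m * 2))) (sym (m*n/n≡m (suc m) 2)) collatzMatrix-hasRank
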